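{- Let $a,b,c\in\mathbb{Z}$. Then there exists $h\in\mathbb{Z}$ such that either $\mathcal{R}_H(a,b,c)=\mathcal{R}_H(0,0,0)+h$, or $\mathcal{R}_H(a,b,c)=\mathcal{R}_H(0,1,1)+h=\mathcal{R}_H(1,0,1)+h=\mathcal{R}_H(1,1,0)+h$.
   Context: Define $H'(x,y,z)=(-x+1+y+z,\,y,\,z)$, $H''(x,y,z)=(x,\,-y+1+z+x,\,z)$, $H'''(x,y,z)=(x,\,y,\,-z+1+x+y)$ on $\mathbb{Z}^3$. $\mathcal{T}_H(a,b,c)$ is the set of all triples obtained from $(a,b,c)$ by applying any finite (possibly empty) sequence of $H',H'',H'''$; $\mathcal{R}_H(a,b,c)$ is the set of integers occurring as a component of some triple in $\mathcal{T}_H(a,b,c)$. For a set $\mathcal{S}\subseteq\mathbb{Z}$, $\mathcal{S}+h=\{s+h:s\in\mathcal{S}\}$. -}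

module Defs where

open import Data.Integer using (ℤ; _+_; -_; +_; _-_)
open import Data.Product using (_×_; _,_; ∃-syntax)
open import Data.Sum using (_⊎_)
open import Relation.Binary.PropositionalEquality using (_≡_)
open import Function.Bundles using (_⇔_)

Triple : Set
Triple = ℤ × ℤ × ℤ

H₁ H₂ H₃ : Triple → Triple
H₁ (x , y , z) = (- x + + 1 + y + z , y , z)
H₂ (x , y , z) = (x , - y + + 1 + z + x , z)
H₃ (x , y , z) = (x , y , - z + + 1 + x + y)

data T (t : Triple) : Triple → Set where
  start : T t t
  step₁ : ∀ {s} → T t s → T t (H₁ s)
  step₂ : ∀ {s} → T t s → T t (H₂ s)
  step₃ : ∀ {s} → T t s → T t (H₃ s)

Component : ℤ → Triple → Set
Component n (x , y , z) = (n ≡ x) ⊎ (n ≡ y) ⊎ (n ≡ z)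

R : Triple → ℤ → Set
R t n = ∃[ s ] (T t s × Component n s)

_≐_ : (ℤ → Set) → (ℤ → Set) → Set
P ≐ Q = ∀ n → P n ⇔ Q n

_⊕_ : (ℤ → Set) → ℤ → (ℤ → Set)
(S ⊕ h) n = ∃[ s ] (S s × n ≡ s + h)

-- Translating a triple by h translates its whole orbit, hence shifts ℛ_H by h;
-- rotating the coordinates conjugates H' ↦ H''' ↦ H'' ↦ H' and leaves ℛ_H
-- fixed. Up to rotation the largest entry comes first, say (x , y , z) with
-- y , z ≤ x. If (x - y) + (x - z) ≥ 2, then H' lowers the potential
-- (x - y)² + (y - z)² + (z - x)² by 2((x - y) + (x - z) - 1) > 0; otherwise the
-- triple is a translate of (0,0,0), (1,0,1) or (1,1,0). Descent on the potential
-- therefore reaches a translate of (0,0,0) or of a rotation of (0,1,1), and the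
-- three rotations of (0,1,1) have the same ℛ_H.
module Submission where

open import Defs
open import Data.Integer using (ℤ; +_; -[1+_]; _+_; _-_; -_; _*_; ∣_∣; _≤_)
import Data.Integer.Properties as ℤ
open import Data.Integer.Tactic.RingSolver using (solve-∀)
open import Data.Nat as ℕ using (ℕ; suc; s≤s; z≤n)
import Data.Nat.Properties as ℕ
open import Data.Nat.Induction using (<-wellFounded)
open import Induction.WellFounded using (module All)
open import Relation.Binary.Construct.On using (wellFounded)
open import Data.Product as Product using (_×_; _,_; ∃-syntax)
open import Data.Sum as Sum using (_⊎_; inj₁; inj₂)
open import Function using (_∘_)
open import Function.Bundles using (mk⇔; Equivalence)
import Function.Properties.Equivalence as ⇔
open import Relation.Binary.PropositionalEquality

T-trans : ∀ {t s r} → T t s → T s r → T t r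
T-trans p start     = p
T-trans p (step₁ q) = step₁ (T-trans p q)
T-trans p (step₂ q) = step₂ (T-trans p q)
T-trans p (step₃ q) = step₃ (T-trans p q)

rotate : Triple → Triple
rotate (x , y , z) = (y , z , x)

-- rotate ∘ H₁ = H₃ ∘ rotate, rotate ∘ H₂ = H₁ ∘ rotate, rotate ∘ H₃ = H₂ ∘ rotate
-- and rotate ∘ rotate ∘ rotate = id, all definitionally.
T-rotate : ∀ {t s} → T t s → T (rotate t) (rotate s)
T-rotate start     = start
T-rotate (step₁ p) = step₃ (T-rotate p)
T-rotate (step₂ p) = step₁ (T-rotate p)
T-rotate (step₃ p) = step₂ (T-rotate p)

H₁-involutive : ∀ s → H₁ (H₁ s) ≡ s
H₁-involutive (x , y , z) = cong (_, y , z) (identity x y z)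
  where
  identity : ∀ x y z → - (- x + + 1 + y + z) + + 1 + y + z ≡ x
  identity = solve-∀

H₂-involutive : ∀ s → H₂ (H₂ s) ≡ s
H₂-involutive s = cong (rotate ∘ rotate) (H₁-involutive (rotate s))

H₃-involutive : ∀ s → H₃ (H₃ s) ≡ s
H₃-involutive s = cong rotate (H₁-involutive (rotate (rotate s)))

T-sym : ∀ {t s} → T t s → T s t
T-sym start         = start
T-sym (step₁ {s} p) = T-trans (subst (T (H₁ s)) (H₁-involutive s) (step₁ start)) (T-sym p)
T-sym (step₂ {s} p) = T-trans (subst (T (H₂ s)) (H₂-involutive s) (step₂ start)) (T-sym p)
T-sym (step₃ {s} p) = T-trans (subst (T (H₃ s)) (H₃-involutive s) (step₃ start)) (T-sym p)

≐-sym : ∀ {P Q} → P ≐ Q → Q ≐ P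
≐-sym e n = ⇔.sym (e n)

≐-trans : ∀ {P Q S} → P ≐ Q → Q ≐ S → P ≐ S
≐-trans e f n = ⇔.trans (e n) (f n)

⊕-cong : ∀ {P Q h} → P ≐ Q → (P ⊕ h) ≐ (Q ⊕ h)
⊕-cong e n = mk⇔ (Product.map₂ (Product.map₁ (Equivalence.to (e _))))
                 (Product.map₂ (Product.map₁ (Equivalence.from (e _))))

R-orbit : ∀ {t s} → T t s → R t ≐ R s
R-orbit p n = mk⇔ (λ (r , q , c) → r , T-trans (T-sym p) q , c)
                  (λ (r , q , c) → r , T-trans p q , c)

Component-rotate : ∀ {n} s → Component n s → Component n (rotate s)
Component-rotate _ (inj₁ e)        = inj₂ (inj₂ e)
Component-rotate _ (inj₂ (inj₁ e)) = inj₁ e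
Component-rotate _ (inj₂ (inj₂ e)) = inj₂ (inj₁ e)

R-rotate : ∀ t → R (rotate t) ≐ R t
R-rotate t n = mk⇔
  (λ (r , q , c) → rotate (rotate r) , T-rotate (T-rotate q)
                 , Component-rotate (rotate r) (Component-rotate r c))
  (λ (r , q , c) → rotate r , T-rotate q , Component-rotate r c)

_⊞_ : Triple → ℤ → Triple
(x , y , z) ⊞ h = (x + h , y + h , z + h)

H₁-⊞ : ∀ s h → H₁ (s ⊞ h) ≡ H₁ s ⊞ h
H₁-⊞ (x , y , z) h = cong (_, y + h , z + h) (identity x y z h)
  where
  identity : ∀ x y z h → - (x + h) + + 1 + (y + h) + (z + h) ≡ (- x + + 1 + y + z) + h
  identity = solve-∀

H₂-⊞ : ∀ s h → H₂ (s ⊞ h) ≡ H₂ s ⊞ h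
H₂-⊞ s h = cong (rotate ∘ rotate) (H₁-⊞ (rotate s) h)

H₃-⊞ : ∀ s h → H₃ (s ⊞ h) ≡ H₃ s ⊞ h
H₃-⊞ s h = cong rotate (H₁-⊞ (rotate (rotate s)) h)

T-⊞ : ∀ {t s} h → T t s → T (t ⊞ h) (s ⊞ h)
T-⊞ h start         = start
T-⊞ h (step₁ {s} p) = subst (T _) (H₁-⊞ s h) (step₁ (T-⊞ h p))
T-⊞ h (step₂ {s} p) = subst (T _) (H₂-⊞ s h) (step₂ (T-⊞ h p))
T-⊞ h (step₃ {s} p) = subst (T _) (H₃-⊞ s h) (step₃ (T-⊞ h p))

T-⊞⁻ : ∀ {t r} h → T (t ⊞ h) r → ∃[ s ] (T t s × r ≡ s ⊞ h)
T-⊞⁻ {t} h start = t , start , refl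
T-⊞⁻ h (step₁ p) with s , q , refl ← T-⊞⁻ h p = H₁ s , step₁ q , H₁-⊞ s h
T-⊞⁻ h (step₂ p) with s , q , refl ← T-⊞⁻ h p = H₂ s , step₂ q , H₂-⊞ s h
T-⊞⁻ h (step₃ p) with s , q , refl ← T-⊞⁻ h p = H₃ s , step₃ q , H₃-⊞ s h

Component-⊞ : ∀ {m} s h → Component m s → Component (m + h) (s ⊞ h)
Component-⊞ _ h = Sum.map (cong (_+ h)) (Sum.map (cong (_+ h)) (cong (_+ h)))

Component-⊞⁻ : ∀ {n} s h → Component n (s ⊞ h) → ∃[ m ] (Component m s × n ≡ m + h)
Component-⊞⁻ (x , y , z) h (inj₁ e)        = x , inj₁ refl , e
Component-⊞⁻ (x , y , z) h (inj₂ (inj₁ e)) = y , inj₂ (inj₁ refl) , e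
Component-⊞⁻ (x , y , z) h (inj₂ (inj₂ e)) = z , inj₂ (inj₂ refl) , e

R-⊞ : ∀ t h → R (t ⊞ h) ≐ (R t ⊕ h)
R-⊞ t h n = mk⇔ to from
  where
  to : R (t ⊞ h) n → (R t ⊕ h) n
  to (r , p , c) with s , q , refl ← T-⊞⁻ h p with m , c′ , e ← Component-⊞⁻ s h c =
    m , (s , q , c′) , e
  from : (R t ⊕ h) n → R (t ⊞ h) n
  from (m , (s , q , c) , refl) = s ⊞ h , T-⊞ h q , Component-⊞ s h c

-- rotate v₂ = v₁ and rotate v₃ = v₂ definitionally, also after translation.
o v₁ v₂ v₃ : Triple
o  = (+ 0 , + 0 , + 0)
v₁ = (+ 0 , + 1 , + 1)
v₂ = (+ 1 , + 0 , + 1)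
v₃ = (+ 1 , + 1 , + 0)

Classified : Triple → Set
Classified t = ∃[ h ] ((R t ≐ (R o ⊕ h)) ⊎ (R t ≐ (R v₁ ⊕ h)))

Classified-orbit : ∀ {t s} → T t s → Classified s → Classified t
Classified-orbit p = Product.map₂ (Sum.map (≐-trans (R-orbit p)) (≐-trans (R-orbit p)))

Classified-rotate : ∀ t → Classified (rotate t) → Classified t
Classified-rotate t =
  Product.map₂ (Sum.map (≐-trans (≐-sym (R-rotate t))) (≐-trans (≐-sym (R-rotate t))))

Classified-o : ∀ h → Classified (o ⊞ h)
Classified-o h = h , inj₁ (R-⊞ o h)

Classified-v₂ : ∀ h → Classified (v₂ ⊞ h)
Classified-v₂ h = Classified-rotate (v₂ ⊞ h) (h , inj₂ (R-⊞ v₁ h))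

Classified-v₃ : ∀ h → Classified (v₃ ⊞ h)
Classified-v₃ h = Classified-rotate (v₃ ⊞ h) (Classified-v₂ h)

squareSum : Triple → ℤ
squareSum (x , y , z) = (x - y) * (x - y) + (y - z) * (y - z) + (z - x) * (z - x)

potential : Triple → ℕ
potential t = ∣ squareSum t ∣

i*i≡+∣i∣*∣i∣ : ∀ i → i * i ≡ + (∣ i ∣ ℕ.* ∣ i ∣)
i*i≡+∣i∣*∣i∣ (+ 0)     = refl
i*i≡+∣i∣*∣i∣ (+ suc n) = refl
i*i≡+∣i∣*∣i∣ -[1+ n ]  = refl

potential-squareSum : ∀ t → + potential t ≡ squareSum t
potential-squareSum (x , y , z)
  rewrite i*i≡+∣i∣*∣i∣ (x - y) | i*i≡+∣i∣*∣i∣ (y - z) | i*i≡+∣i∣*∣i∣ (z - x) = refl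

potential-rotate : ∀ t → potential (rotate t) ≡ potential t
potential-rotate (x , y , z) = cong ∣_∣ (trans (ℤ.+-comm (b + c) a) (sym (ℤ.+-assoc a b c)))
  where
  a = (x - y) * (x - y)
  b = (y - z) * (y - z)
  c = (z - x) * (z - x)

squareSum-H₁ : ∀ x y z →
  squareSum (x , y , z) ≡ squareSum (H₁ (x , y , z)) + + 2 * ((x - y) + (x - z) - + 1)
squareSum-H₁ = identity
  where
  identity : ∀ x y z →
    (x - y) * (x - y) + (y - z) * (y - z) + (z - x) * (z - x)
    ≡ ((- x + + 1 + y + z) - y) * ((- x + + 1 + y + z) - y) + (y - z) * (y - z)
      + (z - (- x + + 1 + y + z)) * (z - (- x + + 1 + y + z))
      + + 2 * ((x - y) + (x - z) - + 1)
  identity = solve-∀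

potential-H₁-< : ∀ x y z k → (x - y) + (x - z) ≡ + (2 ℕ.+ k) →
                 potential (H₁ (x , y , z)) ℕ.< potential (x , y , z)
potential-H₁-< x y z k excess =
  subst (potential t′ ℕ.<_) (sym decrease) (ℕ.m<m+n _ (s≤s z≤n))
  where
  t = (x , y , z)
  t′ = H₁ t
  decrease : potential t ≡ potential t′ ℕ.+ 2 ℕ.* suc k
  decrease = ℤ.+-injective (begin
    + potential t                                        ≡⟨ potential-squareSum t ⟩
    squareSum t                                          ≡⟨ squareSum-H₁ x y z ⟩
    squareSum t′ + + 2 * ((x - y) + (x - z) - + 1)       ≡⟨ cong (λ d → squareSum t′ + + 2 * (d - + 1)) excess ⟩
    squareSum t′ + + (2 ℕ.* suc k)                       ≡⟨ cong (_+ + (2 ℕ.* suc k)) (potential-squareSum t′) ⟨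
    + (potential t′ ℕ.+ 2 ℕ.* suc k)                     ∎)
    where open ≡-Reasoning

Descent : Triple → Set
Descent t = ∀ {s} → potential s ℕ.< potential t → Classified s

Descent-rotate : ∀ t → Descent t → Descent (rotate t)
Descent-rotate t rec {s} = rec ∘ subst (potential s ℕ.<_) (potential-rotate t)

apex : ℤ → ℕ → ℕ → Triple
apex x p q = (x , x - + p , x - + q)

apex-excess : ∀ x p q → (x - (x - + p)) + (x - (x - + q)) ≡ + (p ℕ.+ q)
apex-excess x p q = identity x (+ p) (+ q)
  where
  identity : ∀ x p q → (x - (x - p)) + (x - (x - q)) ≡ p + q
  identity = solve-∀

1+[x-1]≡x : ∀ x → + 1 + (x - + 1) ≡ x
1+[x-1]≡x = solve-∀

o-apex : ∀ x → o ⊞ x ≡ apex x 0 0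
o-apex x = cong₂ _,_ (ℤ.+-identityˡ x) (cong₂ _,_ (ℤ.+-comm (+ 0) x) (ℤ.+-comm (+ 0) x))

v₂-apex : ∀ x → v₂ ⊞ (x - + 1) ≡ apex x 1 0
v₂-apex x = cong₂ _,_ (1+[x-1]≡x x)
  (cong₂ _,_ (ℤ.+-identityˡ (x - + 1)) (trans (1+[x-1]≡x x) (sym (ℤ.+-identityʳ x))))

v₃-apex : ∀ x → v₃ ⊞ (x - + 1) ≡ apex x 0 1
v₃-apex x = cong₂ _,_ (1+[x-1]≡x x)
  (cong₂ _,_ (trans (1+[x-1]≡x x) (sym (ℤ.+-identityʳ x))) (ℤ.+-identityˡ (x - + 1)))

Classified-apex-H₁ : ∀ x p q k → p ℕ.+ q ≡ 2 ℕ.+ k →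
                     Descent (apex x p q) → Classified (apex x p q)
Classified-apex-H₁ x p q k p+q≡2+k rec = Classified-orbit (step₁ start) (rec descends)
  where
  descends : potential (H₁ (apex x p q)) ℕ.< potential (apex x p q)
  descends = potential-H₁-< x (x - + p) (x - + q) k (trans (apex-excess x p q) (cong +_ p+q≡2+k))

Classified-apex : ∀ x p q → Descent (apex x p q) → Classified (apex x p q)
Classified-apex x 0 0 _ = subst Classified (o-apex x) (Classified-o x)
Classified-apex x 1 0 _ = subst Classified (v₂-apex x) (Classified-v₂ (x - + 1))
Classified-apex x 0 1 _ = subst Classified (v₃-apex x) (Classified-v₃ (x - + 1))
Classified-apex x p@(suc (suc _)) q = Classified-apex-H₁ x p q _ refl
Classified-apex x 1 q@(suc _)       = Classified-apex-H₁ x 1 q _ refl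
Classified-apex x 0 q@(suc (suc _)) = Classified-apex-H₁ x 0 q _ refl

peak≡apex : ∀ {x y z} → y ≤ x → z ≤ x → (x , y , z) ≡ apex x ∣ y - x ∣ ∣ z - x ∣
peak≡apex {x} {y} {z} y≤x z≤x = cong (x ,_) (cong₂ _,_ (lower y≤x) (lower z≤x))
  where
  lower : ∀ {w} → w ≤ x → w ≡ x - + ∣ w - x ∣
  lower {w} w≤x = trans (identity x w) (cong (λ d → x - d) (sym (ℤ.∣-∣-≤ w≤x)))
    where
    identity : ∀ x w → w ≡ x - (x - w)
    identity = solve-∀

Classified-peak : ∀ {x y z} → y ≤ x → z ≤ x → Descent (x , y , z) → Classified (x , y , z)
Classified-peak y≤x z≤x rec = subst Classified (sym eq) (Classified-apex _ _ _ (subst Descent eq rec))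
  where eq = peak≡apex y≤x z≤x

Classified-peak₂ : ∀ {x y z} → x ≤ y → z ≤ y → Descent (x , y , z) → Classified (x , y , z)
Classified-peak₂ {x} {y} {z} x≤y z≤y rec =
  Classified-rotate _ (Classified-peak z≤y x≤y (Descent-rotate (x , y , z) rec))

Classified-peak₃ : ∀ {x y z} → x ≤ z → y ≤ z → Descent (x , y , z) → Classified (x , y , z)
Classified-peak₃ {x} {y} {z} x≤z y≤z rec =
  Classified-rotate _ (Classified-peak₂ y≤z x≤z (Descent-rotate (x , y , z) rec))

Classified-descent : ∀ t → Descent t → Classified t
Classified-descent (x , y , z) with ℤ.≤-total y x | ℤ.≤-total z x | ℤ.≤-total z y
... | inj₁ y≤x | inj₁ z≤x | _        = Classified-peak y≤x z≤x
... | inj₁ y≤x | inj₂ x≤z | _        = Classified-peak₃ x≤z (ℤ.≤-trans y≤x x≤z)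
... | inj₂ x≤y | _        | inj₁ z≤y = Classified-peak₂ x≤y z≤y
... | inj₂ x≤y | _        | inj₂ y≤z = Classified-peak₃ (ℤ.≤-trans x≤y y≤z) y≤z

classify : ∀ t → Classified t
classify = All.wfRec (wellFounded potential <-wellFounded) _ Classified Classified-descent

theorem2p3 : (a b c : ℤ) → ∃[ h ]
    ((R (a , b , c) ≐ (R (+ 0 , + 0 , + 0) ⊕ h))
    ⊎ ((R (a , b , c) ≐ (R (+ 0 , + 1 , + 1) ⊕ h))
    × ((R (+ 0 , + 1 , + 1) ⊕ h) ≐ (R (+ 1 , + 0 , + 1) ⊕ h))
    × ((R (+ 1 , + 0 , + 1) ⊕ h) ≐ (R (+ 1 , + 1 , + 0) ⊕ h))))
theorem2p3 a b c =
  Product.map₂ (Sum.map₂ (_, ⊕-cong (R-rotate v₂) , ⊕-cong (R-rotate v₃))) (classify (a , b , c))
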